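{- For every tournament $T$, $\vec{\omega}(T) \le \sqrt{2|V(T)|}$.
   Context: A tournament is a finite directed graph $T$ such that for each pair of distinct vertices $u,w$ exactly one of $(u,w)$, $(w,u)$ is an arc. For a linear order $\ll$ on $V(T)$, the backedge graph $T^{\ll}$ is the undirected graph with vertex set $V(T)$ in which $\{u,w\}$ is an edge if and only if $(u,w)$ is an arc of $T$ and $w \ll u$. The directed clique number is $\vec{\omega}(T) = \min_{\ll} \omega(T^{\ll})$, the minimum over all linear orders $\ll$ on $V(T)$ of the clique number of the backedge graph. -}

module Defs where

open import Level using (0ℓ)
open import Data.Nat using (ℕ; _*_; _≤_)
open import Data.Fin using (Fin)
open import Data.List using (List; length)
open import Data.List.Membership.Propositional using (_∈_)
open import Data.List.Relation.Unary.Unique.Propositional using (Unique)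
open import Data.Product using (_×_; Σ)
open import Data.Sum using (_⊎_)
open import Data.Empty using (⊥)
open import Relation.Nullary using (¬_)
open import Relation.Binary using (Rel)
open import Relation.Binary.Structures using (IsStrictTotalOrder)
open import Relation.Binary.PropositionalEquality using (_≡_; _≢_)

-- A tournament on the vertex set Fin n (every finite vertex set is in
-- bijection with some Fin n).
record Tournament (n : ℕ) : Set₁ where
  field
    Arc        : Fin n → Fin n → Set
    irreflexive : ∀ u → ¬ Arc u u
    total      : ∀ u w → u ≢ w → Arc u w ⊎ Arc w u
    antisym    : ∀ u w → Arc u w → Arc w u → ⊥

record LinearOrder (n : ℕ) : Set₁ where
  field
    _≪_ : Rel (Fin n) 0ℓ
    isStrictTotalOrder : IsStrictTotalOrder _≡_ _≪_

BackEdge : ∀ {n} → Tournament n → LinearOrder n → Fin n → Fin n → Set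
BackEdge T L u w =
  (Arc u w × (w ≪ u)) ⊎ (Arc w u × (u ≪ w))
  where
  open Tournament T
  open LinearOrder L

IsClique : ∀ {n} → Tournament n → LinearOrder n → List (Fin n) → Set
IsClique T L K =
  Unique K × (∀ {u w} → u ∈ K → w ∈ K → u ≢ w → BackEdge T L u w)

CliqueNumber≤ : ∀ {n} → Tournament n → LinearOrder n → ℕ → Set
CliqueNumber≤ T L k = ∀ K → IsClique T L K → length K ≤ k

-- ω⃗(T) ≤ √(2n), with n = |V(T)|: there is a linear order ≪ such that
-- every clique K of T^≪ satisfies |K| ≤ √(2n), i.e. |K|² ≤ 2n
-- (equivalent for natural |K|).
DirCliqueNumberLeSqrt2n : ∀ {n} → Tournament n → Set₁
DirCliqueNumberLeSqrt2n {n} T =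
  Σ (LinearOrder n) λ L →
    ∀ K → IsClique T L K → length K * length K ≤ 2 * n

{-# OPTIONS --safe #-}
-- Let X be a largest transitive subtournament. Every clique of a backedge graph is
-- transitive, so it has at most |X| vertices. Put X first, in its transitive order
-- (by in-degree inside X): then X contains no backedge, so a clique meets X in at most
-- one vertex. Order the remaining vertices recursively. The induction closes for the
-- stronger bound k (k + 1) ≤ 2n on clique sizes k: writing k = a + b with a ≤ 1,
-- b (b + 1) ≤ 2 (n - |X|) and k ≤ |X| gives k (k + 1) ≤ 2n.
module Submission where

open import Defs
open import Data.Nat using (ℕ; zero; suc; _+_; _*_; _≤_; _<_; z≤n; s≤s)
open import Data.Nat.Properties
  using (≤-refl; ≤-trans; <-trans; <-irrefl; <-asym; <-cmp; <⇒≢; n≤1+n;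
         m≤m+n; m≤n+m; +-comm; +-suc; +-mono-≤; +-cancelˡ-≡; +-cancelˡ-<; *-monoʳ-≤;
         *-distribˡ-+; <-≤-trans; module ≤-Reasoning)
open import Data.Nat.Induction using (<-wellFounded)
open import Data.Nat.Solver using (module +-*-Solver)
open import Data.Fin as Fin using (Fin; toℕ)
open import Data.Fin.Properties using (toℕ-injective)
open import Data.List using (List; []; _∷_; [_]; length; filter; map; _++_; allFin)
open import Data.List.Properties using (filter-notAll; length-tabulate)
open import Data.List.Extrema.Nat using (argmax; argmax-all; f[xs]≤f[argmax])
open import Data.List.Membership.Propositional using (_∈_; _∉_)
open import Data.List.Membership.Propositional.Properties
  using (∈-filter⁺; ∈-filter⁻; ∈-allFin; ∈-++⁺ˡ; ∈-++⁺ʳ; ∈-++⁻; ∈-map⁺; ∈-map⁻)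
open import Data.List.Relation.Binary.Subset.Propositional using (_⊆_)
open import Data.List.Relation.Binary.Sublist.Propositional
  using ([]; _∷_; _∷ʳ_; minimum; lookup) renaming (_⊆_ to _⊑_)
open import Data.List.Relation.Binary.Sublist.Propositional.Properties using (All-resp-⊆; filter-⊆)
open import Data.List.Relation.Unary.Any as Any using (here; there)
open import Data.List.Relation.Unary.All as All using (All; []; _∷_)
open import Data.List.Relation.Unary.AllPairs using ([]; _∷_)
open import Data.List.Relation.Unary.Unique.Propositional using (Unique)
open import Data.List.Relation.Unary.Unique.Propositional.Properties using (filter⁺; allFin⁺)
open import Data.Product using (_×_; _,_; proj₁; proj₂)
open import Data.Sum using (inj₁; inj₂)
open import Function using (id; _∘_; _on_)
open import Function.Definitions using (Injective)
open import Induction.WellFounded using (Acc; acc)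
open import Relation.Nullary using (Dec; yes; no; ¬?; contradiction)
open import Relation.Nullary.Decidable using (map′; _→-dec_)
open import Relation.Unary using (Pred; Decidable)
open import Relation.Unary.Properties using (∁?)
open import Relation.Binary using (Tri; tri<; tri≈; tri>; DecidableEquality)
open import Relation.Binary.Structures using (IsStrictTotalOrder)
open import Relation.Binary.PropositionalEquality
  using (_≡_; _≢_; refl; sym; trans; cong; subst; isEquivalence)

module _ {a} {A : Set a} where

  sublists : List A → List (List A)
  sublists []       = [ [] ]
  sublists (x ∷ xs) = map (x ∷_) (sublists xs) ++ sublists xs

  ∈-sublists⁺ : ∀ {ys xs : List A} → ys ⊑ xs → ys ∈ sublists xs
  ∈-sublists⁺ []                   = here refl
  ∈-sublists⁺ {xs = x ∷ xs} (_ ∷ʳ τ) = ∈-++⁺ʳ (map (x ∷_) (sublists xs)) (∈-sublists⁺ τ)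
  ∈-sublists⁺ (refl ∷ τ)           = ∈-++⁺ˡ (∈-map⁺ _ (∈-sublists⁺ τ))

  ∈-sublists⁻ : ∀ {ys xs : List A} → ys ∈ sublists xs → ys ⊑ xs
  ∈-sublists⁻ {xs = []} (here refl) = []
  ∈-sublists⁻ {xs = x ∷ xs} ys∈ with ∈-++⁻ (map (x ∷_) (sublists xs)) ys∈
  ... | inj₂ ys∈′ = x ∷ʳ ∈-sublists⁻ ys∈′
  ... | inj₁ x∷zs∈ with ∈-map⁻ (x ∷_) x∷zs∈
  ...   | _ , zs∈ , refl = refl ∷ ∈-sublists⁻ zs∈

  Unique-resp-⊒ : ∀ {xs ys : List A} → xs ⊑ ys → Unique ys → Unique xs
  Unique-resp-⊒ []         []         = []
  Unique-resp-⊒ (_ ∷ʳ τ)   (_ ∷ u)    = Unique-resp-⊒ τ u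
  Unique-resp-⊒ (refl ∷ τ) (y∉ ∷ u)   = All-resp-⊆ τ y∉ ∷ Unique-resp-⊒ τ u

  length-filter-∁ : ∀ {p} {P : Pred A p} (P? : Decidable P) xs →
                    length (filter P? xs) + length (filter (∁? P?) xs) ≡ length xs
  length-filter-∁ P? []       = refl
  length-filter-∁ P? (x ∷ xs) with P? x
  ... | yes _ = cong suc (length-filter-∁ P? xs)
  ... | no  _ = trans (+-suc _ _) (cong suc (length-filter-∁ P? xs))

  Unique∧allEqual⇒length≤1 : ∀ {xs : List A} → Unique xs →
                             (∀ {x y} → x ∈ xs → y ∈ xs → x ≡ y) → length xs ≤ 1
  Unique∧allEqual⇒length≤1 {[]}        _                _  = z≤n
  Unique∧allEqual⇒length≤1 {_ ∷ []}    _                _  = s≤s z≤n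
  Unique∧allEqual⇒length≤1 {_ ∷ _ ∷ _} ((x≢y ∷ _) ∷ _) eq =
    contradiction (eq (here refl) (there (here refl))) x≢y

  Unique∧⊆⇒length≤ : DecidableEquality A → ∀ {xs ys : List A} → Unique xs → xs ⊆ ys →
                     length xs ≤ length ys
  Unique∧⊆⇒length≤ _≟_ {[]}     _          _    = z≤n
  Unique∧⊆⇒length≤ _≟_ {x ∷ xs} {ys} (x∉ ∷ u) x∷xs⊆ys =
    ≤-trans (s≤s (Unique∧⊆⇒length≤ _≟_ u xs⊆ys-x))
            (filter-notAll (λ y → ¬? (x ≟ y)) ys
              (Any.map (λ x≡y x≢y → x≢y x≡y) (x∷xs⊆ys (here refl))))
    where
    xs⊆ys-x : xs ⊆ filter (λ y → ¬? (x ≟ y)) ys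
    xs⊆ys-x z∈ = ∈-filter⁺ (λ y → ¬? (x ≟ y)) (x∷xs⊆ys (there z∈)) (All.lookup x∉ z∈)

  on-injective-isStrictTotalOrder : (f : A → ℕ) → Injective _≡_ _≡_ f →
                                    IsStrictTotalOrder _≡_ (_<_ on f)
  on-injective-isStrictTotalOrder f f-inj = record
    { isStrictPartialOrder = record
      { isEquivalence = isEquivalence
      ; irrefl        = λ { refl → <-irrefl refl }
      ; trans         = <-trans
      ; <-resp-≈      = (λ { refl p → p }) , (λ { refl p → p })
      }
    ; compare = compare
    }
    where
    compare : ∀ x y → Tri (f x < f y) (x ≡ y) (f y < f x)
    compare x y with <-cmp (f x) (f y)
    ... | tri< lt ¬eq ¬gt = tri< lt (¬eq ∘ cong f) ¬gt
    ... | tri≈ ¬lt eq ¬gt = tri≈ ¬lt (f-inj eq) ¬gt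
    ... | tri> ¬lt ¬eq gt = tri> ¬lt (¬eq ∘ cong f) gt

triangular-step : ∀ {a b s t k} → a ≤ 1 → b * suc b ≤ 2 * t → a + b ≤ s → s + t ≤ k →
                  (a + b) * suc (a + b) ≤ 2 * k
triangular-step {zero} {b} {s} {t} {k} _ ih _ s+t≤k =
  ≤-trans ih (*-monoʳ-≤ 2 (≤-trans (m≤n+m t s) s+t≤k))
triangular-step {suc zero} {b} {s} {t} {k} _ ih b<s s+t≤k = begin
  suc b * suc (suc b)   ≡⟨ expand b ⟩
  b * suc b + 2 * suc b ≤⟨ +-mono-≤ ih (*-monoʳ-≤ 2 b<s) ⟩
  2 * t + 2 * s         ≡⟨ sym (*-distribˡ-+ 2 t s) ⟩
  2 * (t + s)           ≡⟨ cong (2 *_) (+-comm t s) ⟩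
  2 * (s + t)           ≤⟨ *-monoʳ-≤ 2 s+t≤k ⟩
  2 * k                 ∎
  where
  open ≤-Reasoning
  open +-*-Solver
  expand : ∀ b → suc b * suc (suc b) ≡ b * suc b + 2 * suc b
  expand = solve 1 (λ b → (con 1 :+ b) :* (con 2 :+ b) := b :* (con 1 :+ b) :+ con 2 :* (con 1 :+ b)) refl
triangular-step {suc (suc _)} (s≤s ()) _ _ _

module _ {n : ℕ} (T : Tournament n) where
  open Tournament T
  open import Data.List.Membership.DecPropositional (Fin._≟_ {n}) using (_∈?_; _∉?_)

  arc? : ∀ u w → Dec (Arc u w)
  arc? u w with u Fin.≟ w
  ... | yes refl = no (irreflexive u)
  ... | no u≢w with total u w u≢w
  ...   | inj₁ uw = yes uw
  ...   | inj₂ wu = no (λ uw → antisym u w uw wu)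

  arc⇒≢ : ∀ {u w} → Arc u w → u ≢ w
  arc⇒≢ {u} uw refl = irreflexive u uw

  TransitiveOn : Pred (List (Fin n)) _
  TransitiveOn K = ∀ {u v w} → u ∈ K → v ∈ K → w ∈ K → Arc u v → Arc v w → Arc u w

  transitiveOn? : Decidable TransitiveOn
  transitiveOn? K = map′ fromAll toAll
    (All.all? (λ u → All.all? (λ v → All.all? (λ w →
      arc? u v →-dec (arc? v w →-dec arc? u w)) K) K) K)
    where
    AllTransitive = All (λ u → All (λ v → All (λ w → Arc u v → Arc v w → Arc u w) K) K) K
    fromAll : AllTransitive → TransitiveOn K
    fromAll t u∈ v∈ w∈ = All.lookup (All.lookup (All.lookup t u∈) v∈) w∈
    toAll : TransitiveOn K → AllTransitive
    toAll t = All.tabulate λ u∈ → All.tabulate λ v∈ → All.tabulate λ w∈ → t u∈ v∈ w∈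

  TransitiveOn-resp-⊇ : ∀ {xs ys} → ys ⊆ xs → TransitiveOn xs → TransitiveOn ys
  TransitiveOn-resp-⊇ ys⊆xs t u∈ v∈ w∈ = t (ys⊆xs u∈) (ys⊆xs v∈) (ys⊆xs w∈)

  module _ (L : LinearOrder n) where
    open LinearOrder L
    open IsStrictTotalOrder isStrictTotalOrder using (irrefl; asym) renaming (trans to ≪-trans)

    backEdge⇒≪ : ∀ {u w} → BackEdge T L u w → Arc u w → w ≪ u
    backEdge⇒≪ (inj₁ (_ , w≪u))         _  = w≪u
    backEdge⇒≪ {u} {w} (inj₂ (wu , _)) uw = contradiction wu (antisym u w uw)

    backEdge⇒arc : ∀ {u w} → BackEdge T L u w → w ≪ u → Arc u w
    backEdge⇒arc (inj₁ (uw , _))   _   = uw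
    backEdge⇒arc (inj₂ (_ , u≪w)) w≪u = contradiction w≪u (asym u≪w)

    -- All arcs inside a clique point backwards, so transitivity of ≪ becomes transitivity of Arc.
    IsClique⇒TransitiveOn : ∀ {K} → IsClique T L K → TransitiveOn K
    IsClique⇒TransitiveOn (_ , adj) u∈ v∈ w∈ uv vw =
      backEdge⇒arc (adj u∈ w∈ u≢w) w≪u
      where
      w≪u = ≪-trans (backEdge⇒≪ (adj v∈ w∈ (arc⇒≢ vw)) vw)
                    (backEdge⇒≪ (adj u∈ v∈ (arc⇒≢ uv)) uv)
      u≢w = λ { refl → irrefl refl w≪u }

  inNeighbours : List (Fin n) → Fin n → List (Fin n)
  inNeighbours X v = filter (λ y → arc? y v) X

  indegree : List (Fin n) → Fin n → ℕ
  indegree X v = length (inNeighbours X v)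

  indegree<length : ∀ {X v} → v ∈ X → indegree X v < length X
  indegree<length {X} {v} v∈ =
    filter-notAll (λ y → arc? y v) X (Any.map (λ { refl → irreflexive v }) v∈)

  indegree-<-arc : ∀ {X u w} → Unique X → TransitiveOn X → u ∈ X → w ∈ X → Arc u w →
                   indegree X u < indegree X w
  indegree-<-arc {X} {u} {w} uX tX u∈ w∈ uw =
    Unique∧⊆⇒length≤ Fin._≟_ (u∉in[u] ∷ filter⁺ (λ y → arc? y u) uX) u∷in[u]⊆in[w]
    where
    u∉in[u] : All (λ y → u ≢ y) (inNeighbours X u)
    u∉in[u] = All.tabulate λ y∈ → λ { refl →
      irreflexive u (proj₂ (∈-filter⁻ (λ y → arc? y u) {xs = X} y∈)) }
    u∷in[u]⊆in[w] : (u ∷ inNeighbours X u) ⊆ inNeighbours X w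
    u∷in[u]⊆in[w] (here refl) = ∈-filter⁺ (λ y → arc? y w) u∈ uw
    u∷in[u]⊆in[w] (there y∈) with ∈-filter⁻ (λ y → arc? y u) y∈
    ... | y∈X , yu = ∈-filter⁺ (λ y → arc? y w) y∈X (tX y∈X u∈ w∈ yu uw)

  indegree-injectiveOn : ∀ {X u w} → Unique X → TransitiveOn X → u ∈ X → w ∈ X →
                         indegree X u ≡ indegree X w → u ≡ w
  indegree-injectiveOn uX tX u∈ w∈ eq with _ Fin.≟ _
  ... | yes u≡w = u≡w
  ... | no u≢w with total _ _ u≢w
  ...   | inj₁ uw = contradiction eq (<⇒≢ (indegree-<-arc uX tX u∈ w∈ uw))
  ...   | inj₂ wu = contradiction (sym eq) (<⇒≢ (indegree-<-arc uX tX w∈ u∈ wu))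

  length≤length-∩ : ∀ {xs ys} → Unique xs → xs ⊆ ys → length xs ≤ length (filter (_∈? xs) ys)
  length≤length-∩ uxs xs⊆ys =
    Unique∧⊆⇒length≤ Fin._≟_ uxs (λ x∈ → ∈-filter⁺ (_∈? _) (xs⊆ys x∈) x∈)

  -- Opaque, since unfolding the exponentially long candidate list during unification
  -- makes type checking hang.
  opaque
    maxTransitive : List (Fin n) → List (Fin n)
    maxTransitive vs = argmax length [] (filter transitiveOn? (sublists vs))

    maxTransitive-⊑∧transitive : ∀ vs → maxTransitive vs ⊑ vs × TransitiveOn (maxTransitive vs)
    maxTransitive-⊑∧transitive vs =
      argmax-all length {P = λ X → X ⊑ vs × TransitiveOn X} (minimum vs , λ ())
        (All.tabulate λ X∈ → let X∈sublists , tX = ∈-filter⁻ transitiveOn? {xs = sublists vs} X∈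
                             in ∈-sublists⁻ X∈sublists , tX)

    maxTransitive-maximal : ∀ vs {K} → Unique K → K ⊆ vs → TransitiveOn K →
                            length K ≤ length (maxTransitive vs)
    maxTransitive-maximal vs {K} uK K⊆vs tK = begin
      length K                  ≤⟨ length≤length-∩ uK K⊆vs ⟩
      length K∩vs               ≤⟨ All.lookup (f[xs]≤f[argmax] {f = length} [] _) K∩vs∈candidates ⟩
      length (maxTransitive vs) ∎
      where
      open ≤-Reasoning
      K∩vs : List (Fin n)
      K∩vs = filter (_∈? K) vs
      K∩vs∈candidates : K∩vs ∈ filter transitiveOn? (sublists vs)
      K∩vs∈candidates = ∈-filter⁺ transitiveOn?
        (∈-sublists⁺ (filter-⊆ (_∈? K) vs))
        (TransitiveOn-resp-⊇ (λ u∈ → proj₂ (∈-filter⁻ (_∈? K) {xs = vs} u∈)) tK)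

  rankOrder : (r : Fin n → ℕ) → Injective _≡_ _≡_ r → LinearOrder n
  rankOrder r r-inj = record { isStrictTotalOrder = on-injective-isStrictTotalOrder r r-inj }

  prepend : List (Fin n) → (Fin n → ℕ) → Fin n → ℕ
  prepend X r v with v ∈? X
  ... | yes _ = indegree X v
  ... | no  _ = length X + r v

  module Prepend {X : List (Fin n)} (uX : Unique X) (tX : TransitiveOn X)
                 {r : Fin n → ℕ} (r-inj : Injective _≡_ _≡_ r) where

    prepend-∈ : ∀ {v} → v ∈ X → prepend X r v ≡ indegree X v
    prepend-∈ {v} v∈ with v ∈? X
    ... | yes _  = refl
    ... | no v∉ = contradiction v∈ v∉

    prepend-∉ : ∀ {v} → v ∉ X → prepend X r v ≡ length X + r v
    prepend-∉ {v} v∉ with v ∈? X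
    ... | yes v∈ = contradiction v∈ v∉
    ... | no _   = refl

    indegree<length+ : ∀ {v} → v ∈ X → ∀ {m} → indegree X v < length X + m
    indegree<length+ v∈ {m} = <-≤-trans (indegree<length v∈) (m≤m+n (length X) m)

    prepend-injective : Injective _≡_ _≡_ (prepend X r)
    prepend-injective {u} {w} eq with u ∈? X | w ∈? X
    ... | yes u∈ | yes w∈ = indegree-injectiveOn uX tX u∈ w∈ eq
    ... | yes u∈ | no _   = contradiction eq (<⇒≢ (indegree<length+ u∈))
    ... | no _   | yes w∈ = contradiction (sym eq) (<⇒≢ (indegree<length+ w∈))
    ... | no _   | no _   = r-inj (+-cancelˡ-≡ (length X) _ _ eq)

    L  = rankOrder (prepend X r) prepend-injective
    L′ = rankOrder r r-inj

    clique-∩-length≤1 : ∀ {K} → IsClique T L K → length (filter (_∈? X) K) ≤ 1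
    clique-∩-length≤1 {K} (uK , adj) = Unique∧allEqual⇒length≤1 (filter⁺ (_∈? X) uK) no-backEdge
      where
      ordered : ∀ {u w} → u ∈ X → w ∈ X → Arc u w → prepend X r u < prepend X r w
      ordered u∈ w∈ uw rewrite prepend-∈ u∈ | prepend-∈ w∈ = indegree-<-arc uX tX u∈ w∈ uw
      no-backEdge : ∀ {u w} → u ∈ filter (_∈? X) K → w ∈ filter (_∈? X) K → u ≡ w
      no-backEdge {u} {w} u∈ w∈ with ∈-filter⁻ (_∈? X) u∈ | ∈-filter⁻ (_∈? X) w∈ | u Fin.≟ w
      ... | _ , _ | _ , _ | yes u≡w = u≡w
      ... | u∈K , u∈X | w∈K , w∈X | no u≢w with adj u∈K w∈K u≢w
      ...   | inj₁ (uw , w<u) = contradiction w<u (<-asym (ordered u∈X w∈X uw))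
      ...   | inj₂ (wu , u<w) = contradiction u<w (<-asym (ordered w∈X u∈X wu))

    clique-∖ : ∀ {K} → IsClique T L K → IsClique T L′ (filter (_∉? X) K)
    clique-∖ {K} (uK , adj) = filter⁺ (_∉? X) uK , λ u∈ w∈ u≢w →
      let u∈K , u∉X = ∈-filter⁻ (_∉? X) u∈
          w∈K , w∉X = ∈-filter⁻ (_∉? X) w∈
      in restrict u∉X w∉X (adj u∈K w∈K u≢w)
      where
      <-cancel : ∀ {u w} → u ∉ X → w ∉ X → prepend X r u < prepend X r w → r u < r w
      <-cancel {u} {w} u∉ w∉ lt rewrite prepend-∉ u∉ | prepend-∉ w∉ =
        +-cancelˡ-< (length X) _ _ lt
      restrict : ∀ {u w} → u ∉ X → w ∉ X → BackEdge T L u w → BackEdge T L′ u w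
      restrict u∉ w∉ (inj₁ (uw , w<u)) = inj₁ (uw , <-cancel w∉ u∉ w<u)
      restrict u∉ w∉ (inj₂ (wu , u<w)) = inj₂ (wu , <-cancel u∉ w∉ u<w)

  record SmallCliqueRanking (vs : List (Fin n)) : Set where
    field
      rank           : Fin n → ℕ
      rank-injective : Injective _≡_ _≡_ rank
      small-cliques  : ∀ K → K ⊆ vs → IsClique T (rankOrder rank rank-injective) K →
                       length K * suc (length K) ≤ 2 * length vs

  smallCliqueRanking : ∀ vs → Unique vs → Acc _<_ (length vs) → SmallCliqueRanking vs
  smallCliqueRanking [] _ _ = record
    { rank = toℕ ; rank-injective = toℕ-injective ; small-cliques = only-empty }
    where
    only-empty : ∀ K → K ⊆ [] → _ → length K * suc (length K) ≤ 0
    only-empty []      _    _ = z≤n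
    only-empty (_ ∷ _) K⊆[] _ with K⊆[] (here refl)
    ... | ()
  smallCliqueRanking vs@(v ∷ _) uvs (acc rec) = record
    { rank = prepend X r ; rank-injective = prepend-injective ; small-cliques = small-cliques }
    where
    X = maxTransitive vs
    X⊑vs : X ⊑ vs
    X⊑vs = proj₁ (maxTransitive-⊑∧transitive vs)
    tX : TransitiveOn X
    tX = proj₂ (maxTransitive-⊑∧transitive vs)
    uX : Unique X
    uX = Unique-resp-⊒ X⊑vs uvs
    X⊆vs : X ⊆ vs
    X⊆vs = lookup X⊑vs

    R = filter (_∉? X) vs

    |X|+|R|≤|vs| : length X + length R ≤ length vs
    |X|+|R|≤|vs| = subst (length X + length R ≤_) (length-filter-∁ (_∈? X) vs)
      (+-mono-≤ (length≤length-∩ uX X⊆vs) ≤-refl)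

    |R|<|vs| : length R < length vs
    |R|<|vs| = <-≤-trans (+-mono-≤ 1≤|X| ≤-refl) |X|+|R|≤|vs|
      where
      1≤|X| : 1 ≤ length X
      1≤|X| = maxTransitive-maximal vs ([] ∷ []) (λ { (here refl) → here refl })
                (λ { (here refl) (here refl) _ vv _ → contradiction vv (irreflexive v) })

    open SmallCliqueRanking (smallCliqueRanking R (filter⁺ (_∉? X) uvs) (rec |R|<|vs|))
      renaming (rank to r; rank-injective to r-inj; small-cliques to small-cliques-R)
    open Prepend uX tX r-inj

    small-cliques : ∀ K → K ⊆ vs → IsClique T L K → length K * suc (length K) ≤ 2 * length vs
    small-cliques K K⊆vs K-clique = subst (λ k → k * suc k ≤ 2 * length vs)
      (length-filter-∁ (_∈? X) K)
      (triangular-step (clique-∩-length≤1 K-clique) IH |K|≤|X| |X|+|R|≤|vs|)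
      where
      K∖X = filter (_∉? X) K
      K∖X⊆R : K∖X ⊆ R
      K∖X⊆R u∈ = let u∈K , u∉X = ∈-filter⁻ (_∉? X) u∈
                 in ∈-filter⁺ (_∉? X) (K⊆vs u∈K) u∉X
      IH : length K∖X * suc (length K∖X) ≤ 2 * length R
      IH = small-cliques-R K∖X K∖X⊆R (clique-∖ K-clique)
      |K|≤|X| : length (filter (_∈? X) K) + length K∖X ≤ length X
      |K|≤|X| = subst (_≤ length X) (sym (length-filter-∁ (_∈? X) K))
        (maxTransitive-maximal vs (proj₁ K-clique) K⊆vs (IsClique⇒TransitiveOn L K-clique))

corollary3 : (n : ℕ) (T : Tournament n) → DirCliqueNumberLeSqrt2n T
corollary3 n T = rankOrder T rank rank-injective , λ K K-clique → begin
  length K * length K       ≤⟨ *-monoʳ-≤ (length K) (n≤1+n (length K)) ⟩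
  length K * suc (length K) ≤⟨ small-cliques K (λ {v} _ → ∈-allFin v) K-clique ⟩
  2 * length (allFin n)     ≡⟨ cong (2 *_) (length-tabulate {n = n} id) ⟩
  2 * n                     ∎
  where
  open ≤-Reasoning
  open SmallCliqueRanking (smallCliqueRanking T (allFin n) (allFin⁺ n) (<-wellFounded _))
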